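{- For Büchi automata $A_1=(\mathcal{S}_1,\mathcal{E},\mathcal{I}_1,\mathcal{F}_1,\to_1)$ and $A_2=(\mathcal{S}_2,\mathcal{E},\mathcal{I}_2,\mathcal{F}_2,\to_2)$ over the same set of events, define for $X\subseteq\mathcal{S}_1\times\mathcal{S}_2$ $$\texttt{fsim}^\texttt{R}_\texttt{delay}(X)\triangleq\mu Y.\ \{(s_1,s_2)\mid s_2\in\mathcal{F}_2\wedge\forall e.\forall s_1\xrightarrow{e}_1 s_1'.\exists s_2\xrightarrow{e}_2 s_2'.\ (s_1',s_2')\in X\}\ \cup\ \{(s_1,s_2)\mid \forall e.\forall s_1\xrightarrow{e}_1 s_1'.\exists s_2\xrightarrow{e}_2 s_2'.\ (s_1',s_2')\in Y\},$$ $$\texttt{fsim}^\texttt{L}_\texttt{delay}\triangleq\nu X.\ \texttt{fsim}^\texttt{R}_\texttt{delay}(X)\ \cup\ \{(s_1,s_2)\mid s_1\notin\mathcal{F}_1\wedge\forall e.\forall s_1\xrightarrow{e}_1 s_1'.\exists s_2\xrightarrow{e}_2 s_2'.\ (s_1',s_2')\in X\},$$ $$\texttt{wait}(X)\triangleq\mu Y.\ \{(s_1,s_2)\mid\forall e.\forall s_1\xrightarrow{e}_1 s_1'.\exists s_2\xrightarrow{e}_2 s_2'.\ (s_1',s_2')\in Y\}\ \cup\ X,$$ and $\texttt{fsim}_\texttt{2delay}\triangleq\texttt{wait}(\texttt{fsim}^\texttt{L}_\texttt{delay})$. Then $\texttt{fsim}_\texttt{2delay}$ is strictly weaker than delay simulation: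 for every such pair of automata $\texttt{fsim}^\texttt{L}_\texttt{delay}\subseteq\texttt{fsim}_\texttt{2delay}$, and there exists a pair of Büchi automata for which $\texttt{fsim}^\texttt{L}_\texttt{delay}\subsetneq\texttt{fsim}_\texttt{2delay}$.
   Context: A Büchi automaton $(\mathcal{S},\mathcal{E},\mathcal{I},\mathcal{F},\to)$ consists of a set of states $\mathcal{S}$ (not necessarily finite), a set of events $\mathcal{E}$, initial states $\mathcal{I}\subseteq\mathcal{S}$, accepting states $\mathcal{F}\subseteq\mathcal{S}$, and a labeled transition relation $\to\subseteq\mathcal{S}\times\mathcal{E}\times\mathcal{S}$ (written $s\xrightarrow{e}s'$). $\nu$ and $\mu$ denote greatest and least fixed points of monotone operators on the powerset lattice of $\mathcal{S}_1\times\mathcal{S}_2$. -}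

module Defs where

open import Level using (Level; _⊔_) renaming (suc to lsuc; zero to lzero)
open import Data.Product using (Σ; ∃; ∃-syntax; _×_; _,_)
open import Relation.Nullary using (¬_)
open import Relation.Unary using (Pred; _∈_; _∉_; _⊆_; _∪_)

record Buchi (E : Set) : Set₁ where
  field
    S    : Set
    Init : Pred S lzero
    Acc  : Pred S lzero
    Step : S → E → S → Set

open Buchi public

module _ {E : Set} (A₁ A₂ : Buchi E) where

  Pair : Set
  Pair = S A₁ × S A₂

  Sim : ∀ {ℓ} → Pred Pair ℓ → Pred Pair ℓ
  Sim X (s₁ , s₂) =
    ∀ (e : E) (s₁' : S A₁) → Step A₁ s₁ e s₁' →
      ∃[ s₂' ] (Step A₂ s₂ e s₂' × X (s₁' , s₂'))

  -- fsimR_delay(X) = μY. {(s1,s2) | s2 ∈ F2 ∧ Sim X} ∪ Sim Y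
  -- The least fixed point is given as the inductive family generated by the operator.
  data FsimR {ℓ} (X : Pred Pair ℓ) : Pred Pair ℓ where
    here : ∀ {s₁ s₂} → s₂ ∈ Acc A₂ → (s₁ , s₂) ∈ Sim X → (s₁ , s₂) ∈ FsimR X
    later : ∀ {s₁ s₂} → (s₁ , s₂) ∈ Sim (FsimR X) → (s₁ , s₂) ∈ FsimR X

  FsimLOp : Pred Pair lzero → Pred Pair lzero
  FsimLOp X = FsimR X ∪ (λ p → let (s₁ , _) = p in s₁ ∉ Acc A₁ × p ∈ Sim X)

  -- Greatest fixed point (Knaster–Tarski): union of all post-fixed points.
  ν : (Pred Pair lzero → Pred Pair lzero) → Pred Pair (lsuc lzero)
  ν F p = ∃[ Y ] (Y ⊆ F Y × p ∈ Y)

  FsimL : Pred Pair (lsuc lzero)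
  FsimL = ν FsimLOp

  data Wait {ℓ} (X : Pred Pair ℓ) : Pred Pair ℓ where
    done : ∀ {p} → p ∈ X → p ∈ Wait X
    step : ∀ {p} → p ∈ Sim (Wait X) → p ∈ Wait X

  Fsim2 : Pred Pair (lsuc lzero)
  Fsim2 = Wait FsimL

{-# OPTIONS --safe #-}
-- Inclusion is the base case of the least fixed point wait.  For strictness let A₁
-- accept only in its initial state and then move forever through non-accepting
-- states, and let A₂ loop forever without accepting.  Delay simulation must answer
-- the initial acceptance of A₁ by a later acceptance of A₂, which never comes; but
-- wait lets the pair take that first step outside the simulation, after which A₁
-- never accepts again and A₂ simply mimics it.
module Submission where

open import Defs
open import Data.Bool using (Bool; true; false)
open import Data.Empty using (⊥; ⊥-elim)
open import Data.Product using (∃-syntax; _×_; _,_; proj₁)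
open import Data.Sum using (inj₁; inj₂)
open import Data.Unit using (⊤; tt)
open import Level using (0ℓ)
open import Relation.Binary.PropositionalEquality using (_≡_; refl)
open import Relation.Unary using (Pred; _∈_; _∉_; _⊆_)

module _ {E : Set} {A₁ A₂ : Buchi E} where

  Sim-mono : ∀ {ℓ} {X Y : Pred (Pair A₁ A₂) ℓ} → X ⊆ Y → Sim A₁ A₂ X ⊆ Sim A₁ A₂ Y
  Sim-mono X⊆Y sim e s₁' st with sim e s₁' st
  ... | s₂' , st₂ , x = s₂' , st₂ , X⊆Y x

  FsimL⊆Fsim2 : FsimL A₁ A₂ ⊆ Fsim2 A₁ A₂
  FsimL⊆Fsim2 = done

  Sim-FsimL⊆Fsim2 : Sim A₁ A₂ (FsimL A₁ A₂) ⊆ Fsim2 A₁ A₂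
  Sim-FsimL⊆Fsim2 sim = step (Sim-mono done sim)

  FsimL-Acc₁⇒FsimR : ∀ {s₁ s₂} → s₁ ∈ Acc A₁ → (s₁ , s₂) ∈ FsimL A₁ A₂ →
                     ∃[ X ] (s₁ , s₂) ∈ FsimR A₁ A₂ X
  FsimL-Acc₁⇒FsimR acc (Y , post , p∈Y) with post p∈Y
  ... | inj₁ r          = Y , r
  ... | inj₂ (¬acc , _) = ⊥-elim (¬acc acc)

  -- Without accepting states in A₂ the rule here never applies, and since A₁ can
  -- always move, the rule later cannot hold vacuously either.
  FsimR-empty : (∀ s₂ → s₂ ∉ Acc A₂) → (∀ s₁ → ∃[ e ] ∃[ s₁' ] Step A₁ s₁ e s₁') →
                ∀ {ℓ} {X : Pred (Pair A₁ A₂) ℓ} {p} → p ∉ FsimR A₁ A₂ X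
  FsimR-empty noAcc₂ total (here acc _) = noAcc₂ _ acc
  FsimR-empty noAcc₂ total {p = s₁ , _} (later sim) with total s₁
  ... | e , s₁' , st with sim e s₁' st
  ... | _ , _ , r = FsimR-empty noAcc₂ total r

acceptOnlyTrue : Buchi ⊤
acceptOnlyTrue = record
  { S    = Bool
  ; Init = λ _ → ⊤
  ; Acc  = λ s → s ≡ true
  ; Step = λ _ _ s' → s' ≡ false
  }

neverAccept : Buchi ⊤
neverAccept = record
  { S    = ⊤
  ; Init = λ _ → ⊤
  ; Acc  = λ _ → ⊥
  ; Step = λ _ _ _ → ⊤
  }

false∈FsimL : (false , tt) ∈ FsimL acceptOnlyTrue neverAccept
false∈FsimL = leftFalse , post , refl
  where
  leftFalse : Pred (Pair acceptOnlyTrue neverAccept) 0ℓ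
  leftFalse p = proj₁ p ≡ false

  post : leftFalse ⊆ FsimLOp acceptOnlyTrue neverAccept leftFalse
  post refl = inj₂ ((λ ()) , λ _ _ s₁'≡false → tt , tt , s₁'≡false)

true∈Fsim2 : (true , tt) ∈ Fsim2 acceptOnlyTrue neverAccept
true∈Fsim2 = Sim-FsimL⊆Fsim2 λ { _ _ refl → tt , tt , false∈FsimL }

true∉FsimL : (true , tt) ∉ FsimL acceptOnlyTrue neverAccept
true∉FsimL p∈FsimL with FsimL-Acc₁⇒FsimR refl p∈FsimL
... | _ , r = FsimR-empty (λ _ ()) (λ _ → tt , false , refl) r

theorem5p5 : ((E : Set) (A₁ A₂ : Buchi E) → FsimL A₁ A₂ ⊆ Fsim2 A₁ A₂)
    × (∃[ E ] ∃[ A₁ ] ∃[ A₂ ] (FsimL {E} A₁ A₂ ⊆ Fsim2 A₁ A₂ × ∃[ p ] (p ∈ Fsim2 A₁ A₂ × p ∉ FsimL A₁ A₂)))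
theorem5p5 = (λ _ _ _ → FsimL⊆Fsim2)
  , ⊤ , acceptOnlyTrue , neverAccept , FsimL⊆Fsim2
  , (true , tt) , true∈Fsim2 , true∉FsimL
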